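{- Consider a stable defeasible logic with tag $d$, whose $+d$ inference rule is "We may append $+d\,q$ to $P$ if $C^+$" and whose $-d$ inference rule is "We may append $-d\,q$ to $P$ if $C^-$". Then $C^+\wedge C^-$ is proof-unsatisfiable if and only if $d$ is coherent.
   Context: A defeasible theory $D=(F,R,>)$ consists of a finite set $F$ of literals, a finite set $R$ of rules (each with a finite antecedent set of literals, a type strict/defeasible/defeater and a consequent literal) and an acyclic relation $>$ on $R$. Conclusions have the form $+d\,q$ or $-d\,q$. A defeasible logic is a finite set of inference rules "We may append $\pm d\,q$ to $P$ if $C$", one per tag, with applicability conditions $C(D,q,P)$ (first-order conditions on the theory $D$, the literal $q$ and the sequence $P$ of conclusions so far); a proof from $D$ is a finite sequence of conclusions each appendable by some rule to the sequence preceding it, and $D\vdash c$ if $c$ occurs in some proof from $D$. An inference rule is stable if for every proof $P$ and every proof $Q$ containing $P$ as a subsequence, $C(P)\rightarrow C(Q)$; a logic is stable if all its rules are. A tag $d$ is coherent if for no defeasible theory $D$ and literal $q$ both $D\vdash +dq$ and $D\vdash -dq$. A formula $\psi(D,q,P)$ is proof-satisfiable if there exist a defeasible theory $D$, a literal $q$ and a proof $P$ from $D$ in the logic such that $\psi(D,q,P)$ holds; proof-unsatisfiable otherwise. -}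

module Defs where

open import Data.Nat using (ℕ)
open import Data.Bool using (Bool)
open import Data.List using (List; []; _∷ʳ_)
open import Data.List.Membership.Propositional using (_∈_)
open import Data.List.Relation.Binary.Sublist.Propositional using (_⊆_)
open import Data.Product using (Σ; _×_; _,_; ∃)
open import Data.Empty using (⊥)
open import Relation.Nullary using (¬_)
open import Relation.Binary.Construct.Closure.Transitive using (TransClosure)
open import Function.Bundles using (_⇔_)

-- Atoms are natural numbers; a literal is an atom with a polarity
-- (true = positive, false = negated).
record Literal : Set where
  constructor mkLit
  field
    polarity : Bool
    atom     : ℕ

data RuleType : Set where
  strict defeasible defeater : RuleType

record Rule : Set where
  constructor rule
  field
    antecedent : List Literal
    ruleType   : RuleType
    consequent : Literal

-- The superiority relation is given as a finite list of pairs (r , s)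
-- meaning r > s; it must relate rules of R only and be acyclic
-- (its transitive closure is irreflexive).
record Theory : Set where
  field
    facts : List Literal
    rules : List Rule
    sup   : List (Rule × Rule)
    sup-in-rules : ∀ {r s} → (r , s) ∈ sup → (r ∈ rules) × (s ∈ rules)
    sup-acyclic  : ∀ r → ¬ TransClosure (λ a b → (a , b) ∈ sup) r r

data Sign : Set where
  plus minus : Sign

record Conclusion (Tag : Set) : Set where
  constructor concl
  field
    sign : Sign
    tag  : Tag
    literal : Literal

-- A defeasible logic: a finite set of tags, and for every tag d and sign
-- an inference rule "We may append ±d q to P if C(D,q,P)".
record Logic : Set₁ where
  field
    Tag      : Set
    tags     : List Tag
    tagsAll  : ∀ (t : Tag) → t ∈ tags
    C        : Sign → Tag → Theory → Literal → List (Conclusion Tag) → Set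

module _ (L : Logic) where
  open Logic L

  data IsProof (D : Theory) : List (Conclusion Tag) → Set where
    []   : IsProof D []
    _▷_  : ∀ {P s t q} → IsProof D P → C s t D q P →
           IsProof D (P ∷ʳ concl s t q)

  _⊢_ : Theory → Conclusion Tag → Set
  D ⊢ c = Σ (List (Conclusion Tag)) λ P → IsProof D P × (c ∈ P)

  StableRule : Sign → Tag → Set
  StableRule s t = ∀ (D : Theory) (q : Literal) (P Q : List (Conclusion Tag)) →
    IsProof D P → IsProof D Q → P ⊆ Q → C s t D q P → C s t D q Q

  Stable : Set
  Stable = ∀ s t → StableRule s t

  Coherent : Tag → Set
  Coherent d = ¬ (Σ Theory λ D → Σ Literal λ q →
                   (D ⊢ concl plus d q) × (D ⊢ concl minus d q))

  ProofSatisfiable : (Theory → Literal → List (Conclusion Tag) → Set) → Set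
  ProofSatisfiable ψ = Σ Theory λ D → Σ Literal λ q →
    Σ (List (Conclusion Tag)) λ P → IsProof D P × ψ D q P

  ProofUnsatisfiable : (Theory → Literal → List (Conclusion Tag) → Set) → Set
  ProofUnsatisfiable ψ = ¬ ProofSatisfiable ψ

-- If +d q and -d q both occur in proofs P₁ and P₂, their applicability
-- conditions hold at prefixes A and B of these proofs; A ++ B is again a proof,
-- and stability carries both conditions over to it. Conversely, a proof P
-- satisfying both conditions extends to the two proofs P +d q and P -d q.
module Submission where

open import Defs
open import Data.Product using (_×_; _,_; Σ)
open import Function.Bundles using (_⇔_; mk⇔)
open import Data.List using (List; []; _∷_; _++_; _∷ʳ_)
open import Data.List.Properties using (++-assoc; ++-identityʳ)
open import Data.List.Membership.Propositional using (_∈_)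
open import Data.List.Membership.Propositional.Properties using (∈-++⁻; ∈-++⁺ʳ)
open import Data.List.Relation.Unary.Any using (here)
open import Data.List.Relation.Binary.Sublist.Propositional using (_⊆_; ⊆-refl)
open import Data.List.Relation.Binary.Sublist.Propositional.Properties using (++⁺ˡ; ++⁺ʳ)
open import Data.Sum using (inj₁; inj₂)
open import Relation.Binary.PropositionalEquality using (refl; subst; sym)

module _ (L : Logic) where
  open Logic L

  ∈-proof⇒applicable : ∀ {D P s t q} → IsProof L D P → concl s t q ∈ P →
    Σ (List (Conclusion Tag)) λ A → IsProof L D A × C s t D q A
  ∈-proof⇒applicable (_▷_ {P} pP c) m with ∈-++⁻ P m
  ... | inj₁ m∈P         = ∈-proof⇒applicable pP m∈P
  ... | inj₂ (here refl) = P , pP , c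

  applicable⇒⊢ : ∀ {D P s t q} → IsProof L D P → C s t D q P → _⊢_ L D (concl s t q)
  applicable⇒⊢ {P = P} pP c = P ∷ʳ _ , pP ▷ c , ∈-++⁺ʳ P (here refl)

  module _ (stable : Stable L) where

    -- Each step of Q stays applicable after prefixing P, since Q ⊆ P ++ Q.
    IsProof-++ : ∀ {D} P Q → IsProof L D P → IsProof L D Q → IsProof L D (P ++ Q)
    IsProof-++ P .[] pP [] = subst (IsProof L _) (sym (++-identityʳ P)) pP
    IsProof-++ P .(Q ∷ʳ concl s t q) pP (_▷_ {Q} {s} {t} {q} pQ c) =
      subst (IsProof L _) (++-assoc P Q (concl s t q ∷ []))
        (pPQ ▷ stable s t _ q Q (P ++ Q) pQ pPQ (++⁺ˡ P ⊆-refl) c)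
      where pPQ = IsProof-++ P Q pP pQ

    conflict⇒satisfiable : ∀ {D q d} →
      _⊢_ L D (concl plus d q) → _⊢_ L D (concl minus d q) →
      ProofSatisfiable L (λ D q P → C plus d D q P × C minus d D q P)
    conflict⇒satisfiable {D} {q} {d} (_ , pP₁ , m₁) (_ , pP₂ , m₂)
      with ∈-proof⇒applicable pP₁ m₁ | ∈-proof⇒applicable pP₂ m₂
    ... | A , pA , c⁺ | B , pB , c⁻ =
      D , q , A ++ B , pAB ,
      stable plus d D q A (A ++ B) pA pAB (++⁺ʳ B ⊆-refl) c⁺ ,
      stable minus d D q B (A ++ B) pB pAB (++⁺ˡ A ⊆-refl) c⁻
      where pAB = IsProof-++ A B pA pB

proposition8 : (L : Logic) → Stable L → (d : Logic.Tag L) →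
    ProofUnsatisfiable L (λ D q P → Logic.C L plus d D q P × Logic.C L minus d D q P)
    ⇔ Coherent L d
proposition8 L stable d = mk⇔ unsatisfiable⇒coherent coherent⇒unsatisfiable
  where
  open Logic L using (C)
  Both : Theory → Literal → List (Conclusion (Logic.Tag L)) → Set
  Both D q P = C plus d D q P × C minus d D q P

  unsatisfiable⇒coherent : ProofUnsatisfiable L Both → Coherent L d
  unsatisfiable⇒coherent unsat (D , q , ⊢⁺ , ⊢⁻) =
    unsat (conflict⇒satisfiable L stable ⊢⁺ ⊢⁻)

  coherent⇒unsatisfiable : Coherent L d → ProofUnsatisfiable L Both
  coherent⇒unsatisfiable coh (D , q , P , pP , c⁺ , c⁻) =
    coh (D , q , applicable⇒⊢ L pP c⁺ , applicable⇒⊢ L pP c⁻)
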